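{- Let $G_1, G_2$ be finite abelian groups with $\exp(G_2) \mid \exp(G_1)$. Then \[ \mathsf{g}(G_1 \oplus G_2) \ge \mathsf{g}(G_1) + \mathsf{D}(G_2) - 1. \]
   Context: For a finite abelian group $G$, $\exp(G)$ is its exponent. A sequence over $G$ is a finite unordered list of elements of $G$; it is squarefree if its terms are distinct. The Harborth constant $\mathsf{g}(G)$ is the smallest integer $k$ such that every squarefree sequence over $G$ of length at least $k$ has a subsequence of length exactly $\exp(G)$ with sum $0$. The Davenport constant $\mathsf{D}(G)$ is the smallest integer $k$ such that every (not necessarily squarefree) sequence over $G$ of length at least $k$ has a nonempty subsequence with sum $0$. -}

module Defs where

open import Level using (0ℓ)
open import Data.Nat using (ℕ; zero; suc; _≤_; _<_)
open import Data.Product using (_×_; _,_; proj₁; proj₂; Σ; ∃)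
open import Data.List using (List; []; _∷_; length; foldr; map; cartesianProduct)
open import Data.List.Membership.Propositional using (_∈_)
open import Data.List.Membership.Propositional.Properties using (∈-cartesianProduct⁺)
open import Data.List.Relation.Unary.Unique.Propositional using (Unique)
open import Data.List.Relation.Binary.Sublist.Propositional using (_⊆_)
open import Relation.Binary.PropositionalEquality
open import Relation.Binary.Definitions using (DecidableEquality)
open import Relation.Nullary using (yes; no)
open import Algebra.Structures using (IsAbelianGroup; IsGroup; IsMonoid; IsSemigroup; IsMagma)

record FiniteAbelianGroup : Set₁ where
  infixl 6 _+_
  field
    Carrier        : Set
    _+_            : Carrier → Carrier → Carrier
    0#             : Carrier
    -_             : Carrier → Carrier
    isAbelianGroup : IsAbelianGroup _≡_ _+_ 0# -_
    _≟_            : DecidableEquality Carrier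
    elems          : List Carrier
    complete       : ∀ x → x ∈ elems

  _·_ : ℕ → Carrier → Carrier
  zero  · g = 0#
  suc n · g = g + (n · g)

  σ : List Carrier → Carrier
  σ = foldr _+_ 0#

open FiniteAbelianGroup using (Carrier; elems; complete; isAbelianGroup; 0#; σ; _·_; _≟_) renaming (_+_ to _⊹_; -_ to neg)

_⊕_ : FiniteAbelianGroup → FiniteAbelianGroup → FiniteAbelianGroup
G ⊕ H = record
  { Carrier = Carrier G × Carrier H
  ; _+_ = λ { (a , b) (c , d) → (_⊹_ G a c , _⊹_ H b d) }
  ; 0# = (0# G , 0# H)
  ; -_ = λ { (a , b) → (neg G a , neg H b) }
  ; isAbelianGroup = iag
  ; _≟_ = dec
  ; elems = cartesianProduct (elems G) (elems H)
  ; complete = λ { (a , b) → ∈-cartesianProduct⁺ (complete G a) (complete H b) }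
  }
  where
  module A = IsAbelianGroup (isAbelianGroup G)
  module B = IsAbelianGroup (isAbelianGroup H)
  C = Carrier G × Carrier H
  _∙_ : C → C → C
  (a , b) ∙ (c , d) = (_⊹_ G a c , _⊹_ H b d)
  ε : C
  ε = (0# G , 0# H)
  inv : C → C
  inv (a , b) = (neg G a , neg H b)
  dec : DecidableEquality C
  dec (a , b) (c , d) with _≟_ G a c | _≟_ H b d
  ... | yes refl | yes refl = yes refl
  ... | no p | _ = no λ e → p (cong proj₁ e)
  ... | yes _ | no q = no λ e → q (cong proj₂ e)
  iag : IsAbelianGroup _≡_ _∙_ ε inv
  iag = record
    { isGroup = record
      { isMonoid = record
        { isSemigroup = record
          { isMagma = record { isEquivalence = isEquivalence ; ∙-cong = cong₂ _∙_ }
          ; assoc = λ { (a , b) (c , d) (e , f) → cong₂ _,_ (A.assoc a c e) (B.assoc b d f) }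
          }
        ; identity = (λ { (a , b) → cong₂ _,_ (A.identityˡ a) (B.identityˡ b) })
                   , (λ { (a , b) → cong₂ _,_ (A.identityʳ a) (B.identityʳ b) })
        }
      ; inverse = (λ { (a , b) → cong₂ _,_ (A.inverseˡ a) (B.inverseˡ b) })
                , (λ { (a , b) → cong₂ _,_ (A.inverseʳ a) (B.inverseʳ b) })
      ; ⁻¹-cong = cong inv
      }
    ; comm = λ { (a , b) (c , d) → cong₂ _,_ (A.comm a c) (B.comm b d) }
    }

IsLeast : (ℕ → Set) → ℕ → Set
IsLeast P k = P k × (∀ m → P m → k ≤ m)

IsExponent : FiniteAbelianGroup → ℕ → Set
IsExponent G = IsLeast (λ n → 0 < n × (∀ g → _·_ G n g ≡ 0# G))

-- Sequences over G are lists (order irrelevant); subsequences are sublists;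
-- squarefree = no repeated terms.
-- Property defining the Harborth constant, relative to exponent e.
HarborthProp : (G : FiniteAbelianGroup) → ℕ → ℕ → Set
HarborthProp G e k = ∀ (S : List (Carrier G)) → Unique S → k ≤ length S →
  ∃ λ (T : List (Carrier G)) → T ⊆ S × length T ≡ e × σ G T ≡ 0# G

-- g(G) = k  (given that e = exp(G))
IsHarborth : (G : FiniteAbelianGroup) → ℕ → ℕ → Set
IsHarborth G e = IsLeast (HarborthProp G e)

DavenportProp : (G : FiniteAbelianGroup) → ℕ → Set
DavenportProp G k = ∀ (S : List (Carrier G)) → k ≤ length S →
  ∃ λ (T : List (Carrier G)) → T ⊆ S × 1 ≤ length T × σ G T ≡ 0# G

IsDavenport : FiniteAbelianGroup → ℕ → Set
IsDavenport G = IsLeast (DavenportProp G)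

module Submission where

-- Write g(G₁) = a + 1, D(G₂) = b + 1 and suppose g(G₁ ⊕ G₂) ≤ a + b; the sum has
-- exponent e = exp(G₁).  Take S squarefree over G₁, |S| ≥ a, and T over G₂,
-- |T| ≥ b.  If T contains 0 or a term repeated exp(G₂) times, T has a nonempty
-- zero-sum subsequence.  Otherwise all multiplicities in T are below
-- exp(G₂) ≤ exp(G₁) ≤ |G₁|, so the copies of each term can be tagged with
-- distinct elements of G₁, and (S × {0}) ++ tag(T) is squarefree of length
-- ≥ a + b.  Its zero-sum subsequence of length e either lies in S × {0} or
-- projects to a nonempty zero-sum subsequence of T.  Deciding which case holds
-- for S (zero-sum subsequences can be searched for) yields g(G₁) ≤ a or
-- D(G₂) ≤ b, contradicting minimality.

open import Defs
open import Level using (0ℓ)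
open import Data.Nat using (ℕ; zero; suc; _+_; _*_; _≤_; _<_; z≤n; s≤s; _≤?_; >-nonZero)
import Data.Nat.Properties as ℕ
open import Data.Nat.Divisibility using (_∣_; divides; ∣⇒≤)
open import Data.Product using (_×_; _,_; proj₁; proj₂; ∃)
open import Data.Sum using (_⊎_; inj₁; inj₂)
open import Data.Empty using (⊥-elim)
open import Data.List using (List; []; _∷_; length; map; _++_; replicate; deduplicate)
open import Data.List.Properties using (length-map; length-++; length-replicate; ++-identityʳ)
open import Data.List.Membership.Propositional using (_∈_; _∉_; find; lose)
open import Data.List.Membership.Propositional.Properties
  using (∈-map⁺; ∈-map⁻; ∈-++⁺ˡ; ∈-++⁺ʳ; ∈-++⁻; ∈-deduplicate⁺)
open import Data.List.Membership.Propositional.Properties.WithK using (unique∧set⇒bag)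
import Data.List.Membership.DecPropositional as DecMembership
open import Data.List.Relation.Unary.Any using (Any; here; there; any?)
import Data.List.Relation.Unary.All as All
open import Data.List.Relation.Unary.All.Properties using (¬Any⇒All¬)
open import Data.List.Relation.Unary.AllPairs using ([]; _∷_)
open import Data.List.Relation.Unary.Unique.Propositional using (Unique)
import Data.List.Relation.Unary.Unique.Propositional.Properties as Unique
open import Data.List.Relation.Unary.Unique.DecPropositional.Properties using (deduplicate-!)
open import Data.List.Relation.Binary.Sublist.Propositional using (_⊆_; []; _∷_; _∷ʳ_; minimum; from∈)
import Data.List.Relation.Binary.Sublist.Propositional.Properties as Sublist
open import Data.List.Relation.Binary.BagAndSetEquality using (∼bag⇒↭)
open import Data.List.Relation.Binary.Permutation.Propositional using (_↭_; ↭⇒↭ₛ)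
import Data.List.Relation.Binary.Permutation.Setoid.Properties as Permutation
open import Relation.Binary.PropositionalEquality
open import Relation.Binary.Definitions using (DecidableEquality)
open import Relation.Nullary using (Dec; yes; no; ¬_)
open import Relation.Nullary.Decidable using (map′; _×-dec_)
open import Relation.Unary using (Decidable)
open import Function.Bundles using (mk⇔)
open import Algebra.Bundles using (AbelianGroup)
open import Algebra.Structures using (IsAbelianGroup)
import Algebra.Properties.Group as GroupProperties
import Algebra.Properties.CommutativeSemigroup as CommutativeSemigroupProperties

module _ {A : Set} where

  ⊆-++-split : ∀ (xs ys : List A) {zs} → zs ⊆ xs ++ ys →
    ∃ λ zs₁ → ∃ λ zs₂ → zs ≡ zs₁ ++ zs₂ × zs₁ ⊆ xs × zs₂ ⊆ ys
  ⊆-++-split [] ys p = [] , _ , refl , [] , p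
  ⊆-++-split (x ∷ xs) ys (_ ∷ʳ p) with ⊆-++-split xs ys p
  ... | zs₁ , zs₂ , refl , p₁ , p₂ = zs₁ , zs₂ , refl , x ∷ʳ p₁ , p₂
  ⊆-++-split (x ∷ xs) ys (refl ∷ p) with ⊆-++-split xs ys p
  ... | zs₁ , zs₂ , refl , p₁ , p₂ = x ∷ zs₁ , zs₂ , refl , refl ∷ p₁ , p₂

  sublists : List A → List (List A)
  sublists [] = [] ∷ []
  sublists (x ∷ xs) = map (x ∷_) (sublists xs) ++ sublists xs

  ⊆⇒∈-sublists : ∀ {xs ys} → xs ⊆ ys → xs ∈ sublists ys
  ⊆⇒∈-sublists [] = here refl
  ⊆⇒∈-sublists {ys = y ∷ ys} (_ ∷ʳ p) = ∈-++⁺ʳ (map (y ∷_) (sublists ys)) (⊆⇒∈-sublists p)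
  ⊆⇒∈-sublists (refl ∷ p) = ∈-++⁺ˡ (∈-map⁺ (_ ∷_) (⊆⇒∈-sublists p))

  ∈-sublists⇒⊆ : ∀ {xs} ys → xs ∈ sublists ys → xs ⊆ ys
  ∈-sublists⇒⊆ [] (here refl) = []
  ∈-sublists⇒⊆ (y ∷ ys) m with ∈-++⁻ (map (y ∷_) (sublists ys)) m
  ... | inj₂ m′ = y ∷ʳ ∈-sublists⇒⊆ ys m′
  ... | inj₁ m′ with ∈-map⁻ (y ∷_) m′
  ...   | _ , m″ , refl = refl ∷ ∈-sublists⇒⊆ ys m″

  any-sublist? : {P : List A → Set} → Decidable P → ∀ ys → Dec (∃ λ xs → xs ⊆ ys × P xs)
  any-sublist? {P} P? ys = map′ found search (any? P? (sublists ys))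
    where
    found : Any P (sublists ys) → ∃ λ xs → xs ⊆ ys × P xs
    found a with find a
    ... | xs , m , p = xs , ∈-sublists⇒⊆ ys m , p
    search : (∃ λ xs → xs ⊆ ys × P xs) → Any P (sublists ys)
    search (xs , s , p) = lose (⊆⇒∈-sublists s) p

⊆-map⁻ : ∀ {A B : Set} (f : A → B) xs {ys} → ys ⊆ map f xs → ∃ λ zs → zs ⊆ xs × ys ≡ map f zs
⊆-map⁻ f [] [] = [] , [] , refl
⊆-map⁻ f (x ∷ xs) (_ ∷ʳ p) with ⊆-map⁻ f xs p
... | zs , q , refl = zs , x ∷ʳ q , refl
⊆-map⁻ f (x ∷ xs) (refl ∷ p) with ⊆-map⁻ f xs p
... | zs , q , refl = x ∷ zs , refl ∷ q , refl

module Multiplicity {A : Set} (_≟_ : DecidableEquality A) where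

  multiplicity : A → List A → ℕ
  multiplicity x [] = 0
  multiplicity x (y ∷ ys) with x ≟ y
  ... | yes _ = suc (multiplicity x ys)
  ... | no _ = multiplicity x ys

  multiplicity-head : ∀ x ys → multiplicity x (x ∷ ys) ≡ suc (multiplicity x ys)
  multiplicity-head x ys with x ≟ x
  ... | yes _ = refl
  ... | no x≢x = ⊥-elim (x≢x refl)

  multiplicity-∷ : ∀ x y ys → multiplicity x ys ≤ multiplicity x (y ∷ ys)
  multiplicity-∷ x y ys with x ≟ y
  ... | yes _ = ℕ.n≤1+n _
  ... | no _ = ℕ.≤-refl

  replicate-⊆ : ∀ n x ys → n ≤ multiplicity x ys → replicate n x ⊆ ys
  replicate-⊆ zero x ys _ = minimum ys
  replicate-⊆ (suc n) x (y ∷ ys) n<m with x ≟ y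
  ... | yes refl = refl ∷ replicate-⊆ n x ys (ℕ.≤-pred n<m)
  ... | no _ = y ∷ʳ replicate-⊆ (suc n) x ys n<m

module _ {A : Set} (default : A) where

  nth : List A → ℕ → A
  nth [] i = default
  nth (x ∷ xs) zero = x
  nth (x ∷ xs) (suc i) = nth xs i

  nth-∈ : ∀ xs {i} → i < length xs → nth xs i ∈ xs
  nth-∈ (x ∷ xs) {zero} _ = here refl
  nth-∈ (x ∷ xs) {suc i} i< = there (nth-∈ xs (ℕ.≤-pred i<))

  nth-injective : ∀ {xs} → Unique xs → ∀ {i j} → i < length xs → j < length xs →
    nth xs i ≡ nth xs j → i ≡ j
  nth-injective {_ ∷ xs} _ {zero} {zero} _ _ _ = refl
  nth-injective {_ ∷ xs} (x∉ ∷ _) {zero} {suc j} _ j< eq = ⊥-elim (All.lookup x∉ (nth-∈ xs (ℕ.≤-pred j<)) eq)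
  nth-injective {_ ∷ xs} (x∉ ∷ _) {suc i} {zero} i< _ eq = ⊥-elim (All.lookup x∉ (nth-∈ xs (ℕ.≤-pred i<)) (sym eq))
  nth-injective {_ ∷ xs} (_ ∷ u) {suc i} {suc j} i< j< eq =
    cong suc (nth-injective u (ℕ.≤-pred i<) (ℕ.≤-pred j<) eq)

module Tagging {A B : Set} (_≟_ : DecidableEquality B) (default : A) (labels : List A) where
  open Multiplicity _≟_

  -- Each term t is paired with the label indexed by the number of later copies of t.
  tag : List B → List (A × B)
  tag [] = []
  tag (t ∷ ts) = (nth default labels (multiplicity t ts) , t) ∷ tag ts

  untag : ∀ ts → map proj₂ (tag ts) ≡ ts
  untag [] = refl
  untag (t ∷ ts) = cong (t ∷_) (untag ts)

  length-tag : ∀ ts → length (tag ts) ≡ length ts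
  length-tag ts = trans (sym (length-map proj₂ (tag ts))) (cong length (untag ts))

  tag-label : ∀ ts {p} → p ∈ tag ts →
    ∃ λ i → i < multiplicity (proj₂ p) ts × proj₁ p ≡ nth default labels i
  tag-label (t ∷ ts) (here refl) = multiplicity t ts , ℕ.≤-reflexive (sym (multiplicity-head t ts)) , refl
  tag-label (t ∷ ts) {p} (there m) with tag-label ts m
  ... | i , i< , eq = i , ℕ.<-≤-trans i< (multiplicity-∷ (proj₂ p) t ts) , eq

  tag-unique : Unique labels → ∀ ts → (∀ t → t ∈ ts → multiplicity t ts ≤ length labels) →
    Unique (tag ts)
  tag-unique _ [] _ = []
  tag-unique labels! (t ∷ ts) bounded = All.tabulate fresh ∷ tag-unique labels! ts bounded′
    where
    bounded′ : ∀ x → x ∈ ts → multiplicity x ts ≤ length labels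
    bounded′ x m = ℕ.≤-trans (multiplicity-∷ x t ts) (bounded x (there m))
    in-range : multiplicity t ts < length labels
    in-range = subst (_≤ length labels) (multiplicity-head t ts) (bounded t (here refl))
    fresh : ∀ {p} → p ∈ tag ts → (nth default labels (multiplicity t ts) , t) ≢ p
    fresh m refl with tag-label ts m
    ... | i , i< , eq = ℕ.<-irrefl (nth-injective default labels! (ℕ.<-trans i< in-range) in-range (sym eq)) i<

ZeroSumOfLength : (G : FiniteAbelianGroup) → ℕ → List (FiniteAbelianGroup.Carrier G) → Set
ZeroSumOfLength G n S = ∃ λ T → T ⊆ S × length T ≡ n × FiniteAbelianGroup.σ G T ≡ FiniteAbelianGroup.0# G

NonemptyZeroSum : (G : FiniteAbelianGroup) → List (FiniteAbelianGroup.Carrier G) → Set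
NonemptyZeroSum G S = ∃ λ T → T ⊆ S × 1 ≤ length T × FiniteAbelianGroup.σ G T ≡ FiniteAbelianGroup.0# G

below-least : ∀ {P : ℕ → Set} {k} → IsLeast P (suc k) → ¬ P k
below-least (_ , least) p = ℕ.<-irrefl refl (least _ p)

harborth-mono : ∀ G {e k m} → k ≤ m → HarborthProp G e k → HarborthProp G e m
harborth-mono G k≤m har S S! m≤ = har S S! (ℕ.≤-trans k≤m m≤)

no-harborth-zero : ∀ G {e} → 0 < e → ¬ HarborthProp G e 0
no-harborth-zero G 0<e har with har [] [] z≤n
... | [] , [] , refl , _ = ℕ.<-irrefl refl 0<e

no-davenport-zero : ∀ G → ¬ DavenportProp G 0
no-davenport-zero G dav with dav [] z≤n
... | [] , [] , () , _

module FiniteGroupFacts (G : FiniteAbelianGroup) where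
  open FiniteAbelianGroup G renaming (_+_ to _∙_)
  open IsAbelianGroup isAbelianGroup using (assoc; identityˡ; isCommutativeMonoid)

  abelianGroup : AbelianGroup 0ℓ 0ℓ
  abelianGroup = record
    { Carrier = Carrier ; _≈_ = _≡_ ; _∙_ = _∙_ ; ε = 0# ; _⁻¹ = -_ ; isAbelianGroup = isAbelianGroup }

  open AbelianGroup abelianGroup using (group; commutativeSemigroup)
  open GroupProperties group using (∙-cancelˡ; identityˡ-unique; \\-leftDividesˡ)
  open CommutativeSemigroupProperties commutativeSemigroup using (interchange)

  ·-homo-+ : ∀ m n g → (m + n) · g ≡ m · g ∙ n · g
  ·-homo-+ zero n g = sym (identityˡ _)
  ·-homo-+ (suc m) n g = trans (cong (g ∙_) (·-homo-+ m n g)) (sym (assoc g (m · g) (n · g)))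

  ·-multiple : ∀ q n g → n · g ≡ 0# → (q * n) · g ≡ 0#
  ·-multiple zero n g _ = refl
  ·-multiple (suc q) n g n·g≡0 = begin
    (n + q * n) · g      ≡⟨ ·-homo-+ n (q * n) g ⟩
    n · g ∙ (q * n) · g  ≡⟨ cong₂ _∙_ n·g≡0 (·-multiple q n g n·g≡0) ⟩
    0# ∙ 0#              ≡⟨ identityˡ 0# ⟩
    0#                   ∎
    where open ≡-Reasoning

  σ-++ : ∀ xs ys → σ (xs ++ ys) ≡ σ xs ∙ σ ys
  σ-++ [] ys = sym (identityˡ _)
  σ-++ (x ∷ xs) ys = trans (cong (x ∙_) (σ-++ xs ys)) (sym (assoc x (σ xs) (σ ys)))

  σ-replicate : ∀ n x → σ (replicate n x) ≡ n · x
  σ-replicate zero x = refl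
  σ-replicate (suc n) x = cong (x ∙_) (σ-replicate n x)

  σ-translate : ∀ g xs → σ (map (g ∙_) xs) ≡ length xs · g ∙ σ xs
  σ-translate g [] = sym (identityˡ 0#)
  σ-translate g (x ∷ xs) =
    trans (cong ((g ∙ x) ∙_) (σ-translate g xs)) (interchange g x (length xs · g) (σ xs))

  elements : List Carrier
  elements = deduplicate _≟_ elems

  elements-unique : Unique elements
  elements-unique = deduplicate-! _≟_ elems

  ∈-elements : ∀ x → x ∈ elements
  ∈-elements x = ∈-deduplicate⁺ _≟_ (complete x)

  order : ℕ
  order = length elements

  translate-↭ : ∀ g → elements ↭ map (g ∙_) elements
  translate-↭ g = ∼bag⇒↭ (unique∧set⇒bag elements-unique
    (Unique.map⁺ (λ {x} {y} → ∙-cancelˡ g x y) elements-unique)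
    (mk⇔ (λ _ → ∈-translate _) (λ _ → ∈-elements _)))
    where
    -- every z is the translate of - g ∙ z
    ∈-translate : ∀ z → z ∈ map (g ∙_) elements
    ∈-translate z = subst (_∈ map (g ∙_) elements) (\\-leftDividesˡ g z) (∈-map⁺ (g ∙_) (∈-elements (- g ∙ z)))

  -- |G| annihilates every element: comparing the sums of the elements and of their translates.
  order-annihilates : ∀ g → order · g ≡ 0#
  order-annihilates g = identityˡ-unique (order · g) (σ elements) (sym (begin
    σ elements                 ≡⟨ Permutation.foldr-commMonoid (setoid Carrier) isCommutativeMonoid (↭⇒↭ₛ (translate-↭ g)) ⟩
    σ (map (g ∙_) elements)    ≡⟨ σ-translate g elements ⟩
    order · g ∙ σ elements     ∎))
    where open ≡-Reasoning

  order-positive : 0 < order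
  order-positive with elements | ∈-elements 0#
  ... | _ ∷ _ | _ = s≤s z≤n

  exponent≤order : ∀ {e} → IsExponent G e → e ≤ order
  exponent≤order (_ , least) = least order (order-positive , order-annihilates)

  open Multiplicity _≟_

  zero-term : ∀ {T} → 0# ∈ T → NonemptyZeroSum G T
  zero-term 0∈T = 0# ∷ [] , from∈ 0∈T , s≤s z≤n , identityˡ 0#

  repeated-term : ∀ {e} → IsExponent G e → ∀ t T → e ≤ multiplicity t T → NonemptyZeroSum G T
  repeated-term {e} ((0<e , ann) , _) t T e≤ =
    replicate e t , replicate-⊆ e t T e≤ , subst (1 ≤_) (sym (length-replicate e)) 0<e ,
    trans (σ-replicate e t) (ann t)

  zeroSumOfLength? : ∀ n S → Dec (ZeroSumOfLength G n S)
  zeroSumOfLength? n = any-sublist? (λ T → (length T ℕ.≟ n) ×-dec (σ T ≟ 0#))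

module DirectSum (G₁ G₂ : FiniteAbelianGroup) where
  open FiniteAbelianGroup G₁ using ()
    renaming (Carrier to C₁; _+_ to _+₁_; 0# to 0₁; σ to σ₁; _·_ to _·₁_)
  open FiniteAbelianGroup G₂ using ()
    renaming (Carrier to C₂; _+_ to _+₂_; 0# to 0₂; σ to σ₂; _·_ to _·₂_; _≟_ to _≟₂_)
  private
    module F₁ = FiniteGroupFacts G₁
    module F₂ = FiniteGroupFacts G₂
    σ₁₂ : List (C₁ × C₂) → C₁ × C₂
    σ₁₂ = FiniteAbelianGroup.σ (G₁ ⊕ G₂)
    _·₁₂_ : ℕ → C₁ × C₂ → C₁ × C₂
    _·₁₂_ = FiniteAbelianGroup._·_ (G₁ ⊕ G₂)
  open IsAbelianGroup (FiniteAbelianGroup.isAbelianGroup G₂) using () renaming (identityˡ to +₂-identityˡ)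

  ·-pair : ∀ n a b → n ·₁₂ (a , b) ≡ (n ·₁ a , n ·₂ b)
  ·-pair zero a b = refl
  ·-pair (suc n) a b rewrite ·-pair n a b = refl

  exponent-⊕ : ∀ {e₁ e₂ e} → IsExponent G₁ e₁ → IsExponent G₂ e₂ → e₂ ∣ e₁ →
    IsExponent (G₁ ⊕ G₂) e → e ≡ e₁
  exponent-⊕ {e₁} {e₂} {e} ((0<e₁ , ann₁) , least₁) ((_ , ann₂) , _) (divides q refl)
             ((0<e , ann) , least) =
    ℕ.≤-antisym (least e₁ (0<e₁ , e₁-annihilates)) (least₁ e (0<e , e-annihilates₁))
    where
    e-annihilates₁ : ∀ a → e ·₁ a ≡ 0₁
    e-annihilates₁ a = cong proj₁ (trans (sym (·-pair e a 0₂)) (ann (a , 0₂)))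
    e₁-annihilates : ∀ x → e₁ ·₁₂ x ≡ (0₁ , 0₂)
    e₁-annihilates (a , b) = trans (·-pair e₁ a b) (cong₂ _,_ (ann₁ a) (F₂.·-multiple q e₂ b (ann₂ b)))

  σ-proj₂ : ∀ V → proj₂ (σ₁₂ V) ≡ σ₂ (map proj₂ V)
  σ-proj₂ [] = refl
  σ-proj₂ (v ∷ V) = cong (proj₂ v +₂_) (σ-proj₂ V)

  inl : C₁ → C₁ × C₂
  inl a = (a , 0₂)

  σ-inl : ∀ W → proj₁ (σ₁₂ (map inl W)) ≡ σ₁ W
  σ-inl [] = refl
  σ-inl (w ∷ W) = cong (w +₁_) (σ-inl W)

  σ-inl-++ : ∀ W V → proj₂ (σ₁₂ (map inl W ++ V)) ≡ proj₂ (σ₁₂ V)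
  σ-inl-++ [] V = refl
  σ-inl-++ (w ∷ W) V =
    trans (cong (0₂ +₂_) (σ-inl-++ W V)) (+₂-identityˡ _)

  open Tagging _≟₂_ 0₁ F₁.elements
  open Multiplicity _≟₂_

  embed : List C₁ → List C₂ → List (C₁ × C₂)
  embed S T = map inl S ++ tag T

  length-embed : ∀ S T → length (embed S T) ≡ length S + length T
  length-embed S T = trans (length-++ (map inl S)) (cong₂ _+_ (length-map inl S) (length-tag T))

  embed-unique : ∀ S T → Unique S → 0₂ ∉ T → (∀ t → t ∈ T → multiplicity t T ≤ F₁.order) →
    Unique (embed S T)
  embed-unique S T S! 0∉T bounded =
    Unique.++⁺ (Unique.map⁺ (cong proj₁) S!) (tag-unique F₁.elements-unique T bounded) disjoint
    where
    disjoint : ∀ {v} → ¬ (v ∈ map inl S × v ∈ tag T)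
    disjoint (m₁ , m₂) with ∈-map⁻ inl m₁
    ... | _ , _ , refl = 0∉T (subst (0₂ ∈_) (untag T) (∈-map⁺ proj₂ m₂))

  embed-zero-sum : ∀ S T {n} → ZeroSumOfLength (G₁ ⊕ G₂) n (embed S T) →
    ZeroSumOfLength G₁ n S ⊎ NonemptyZeroSum G₂ T
  embed-zero-sum S T {n} (U , U⊆ , |U| , ΣU) with ⊆-++-split (map inl S) (tag T) U⊆
  ... | Wᵢ , V , refl , Wᵢ⊆ , V⊆ with ⊆-map⁻ inl S Wᵢ⊆
  ...   | W , W⊆ , refl with V
  ...     | [] = inj₁ (W , W⊆ , |W| , ΣW)
    where
    no-tags : map inl W ++ [] ≡ map inl W
    no-tags = ++-identityʳ (map inl W)
    |W| : length W ≡ n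
    |W| = trans (sym (length-map inl W)) (trans (cong length (sym no-tags)) |U|)
    ΣW : σ₁ W ≡ 0₁
    ΣW = trans (sym (σ-inl W)) (trans (cong (λ X → proj₁ (σ₁₂ X)) (sym no-tags)) (cong proj₁ ΣU))
  ...     | v ∷ V′ = inj₂ (map proj₂ (v ∷ V′) , V₂⊆T , s≤s z≤n , ΣV₂)
    where
    V₂⊆T : map proj₂ (v ∷ V′) ⊆ T
    V₂⊆T = subst (map proj₂ (v ∷ V′) ⊆_) (untag T) (Sublist.map⁺ proj₂ V⊆)
    ΣV₂ : σ₂ (map proj₂ (v ∷ V′)) ≡ 0₂
    ΣV₂ = trans (sym (σ-proj₂ (v ∷ V′))) (trans (sym (σ-inl-++ W (v ∷ V′))) (cong proj₂ ΣU))

module Transfer (G₁ G₂ : FiniteAbelianGroup) {e₁ e₂ : ℕ}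
  (exp₁ : IsExponent G₁ e₁) (exp₂ : IsExponent G₂ e₂) (e₂≤e₁ : e₂ ≤ e₁) where
  open FiniteAbelianGroup G₂ using () renaming (0# to 0₂; _≟_ to _≟₂_)
  open Multiplicity _≟₂_
  open DirectSum G₁ G₂
  private
    module F₁ = FiniteGroupFacts G₁
    module F₂ = FiniteGroupFacts G₂

  light-bound : ∀ T → ¬ Any (λ t → e₂ ≤ multiplicity t T) T →
    ∀ t → t ∈ T → multiplicity t T ≤ F₁.order
  light-bound T light t t∈T = ℕ.≤-trans (ℕ.<⇒≤ (ℕ.≰⇒> (All.lookup (¬Any⇒All¬ T light) t∈T)))
                                        (ℕ.≤-trans e₂≤e₁ (F₁.exponent≤order exp₁))

  nonempty-zero-sum : ∀ {k} → HarborthProp (G₁ ⊕ G₂) e₁ k →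
    ∀ S → Unique S → ¬ ZeroSumOfLength G₁ e₁ S →
    ∀ T → k ≤ length S + length T → NonemptyZeroSum G₂ T
  nonempty-zero-sum {k} har S S! ¬zs T k≤
    with DecMembership._∈?_ _≟₂_ 0₂ T | any? (λ t → e₂ ≤? multiplicity t T) T
  ... | yes 0∈T | _ = F₂.zero-term 0∈T
  ... | no _ | yes heavy with find heavy
  ...   | t , _ , e₂≤ = F₂.repeated-term exp₂ t T e₂≤
  nonempty-zero-sum {k} har S S! ¬zs T k≤ | no 0∉T | no light
    with embed-zero-sum S T (har (embed S T) (embed-unique S T S! 0∉T (light-bound T light))
                                 (subst (k ≤_) (sym (length-embed S T)) k≤))
  ... | inj₁ zs = ⊥-elim (¬zs zs)
  ... | inj₂ nz = nz

  harborth-transfer : ∀ {a b} → HarborthProp (G₁ ⊕ G₂) e₁ (a + b) → ¬ DavenportProp G₂ b →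
    HarborthProp G₁ e₁ a
  harborth-transfer har ¬dav S S! a≤ with F₁.zeroSumOfLength? e₁ S
  ... | yes zs = zs
  ... | no ¬zs = ⊥-elim (¬dav λ T b≤ → nonempty-zero-sum har S S! ¬zs T (ℕ.+-mono-≤ a≤ b≤))

lemma3p2 : (G₁ G₂ : FiniteAbelianGroup) (e₁ e₂ e₁₂ g₁ d₂ g₁₂ : ℕ) →
    IsExponent G₁ e₁ → IsExponent G₂ e₂ → IsExponent (G₁ ⊕ G₂) e₁₂ →
    e₂ ∣ e₁ →
    IsHarborth G₁ e₁ g₁ → IsDavenport G₂ d₂ → IsHarborth (G₁ ⊕ G₂) e₁₂ g₁₂ →
    g₁ + d₂ ≤ suc g₁₂
lemma3p2 G₁ G₂ e₁ e₂ e₁₂ zero d₂ g₁₂ exp₁ _ _ _ har₁ _ _ =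
  ⊥-elim (no-harborth-zero G₁ (proj₁ (proj₁ exp₁)) (proj₁ har₁))
lemma3p2 G₁ G₂ e₁ e₂ e₁₂ (suc a) zero g₁₂ _ _ _ _ _ dav₂ _ =
  ⊥-elim (no-davenport-zero G₂ (proj₁ dav₂))
lemma3p2 G₁ G₂ e₁ e₂ e₁₂ (suc a) (suc b) g₁₂ exp₁ exp₂ exp₁₂ e₂∣e₁ har₁ dav₂ har₁₂ with g₁₂ ≤? a + b
... | no g₁₂≰a+b = s≤s (subst (_≤ g₁₂) (sym (ℕ.+-suc a b)) (ℕ.≰⇒> g₁₂≰a+b))
... | yes g₁₂≤a+b = ⊥-elim (below-least har₁ (harborth-transfer har₁₂′ (below-least dav₂)))
  where
  open Transfer G₁ G₂ exp₁ exp₂ (∣⇒≤ {{>-nonZero (proj₁ (proj₁ exp₁))}} e₂∣e₁)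
  har₁₂′ : HarborthProp (G₁ ⊕ G₂) e₁ (a + b)
  har₁₂′ = subst (λ e → HarborthProp (G₁ ⊕ G₂) e (a + b))
                 (DirectSum.exponent-⊕ G₁ G₂ exp₁ exp₂ e₂∣e₁ exp₁₂)
                 (harborth-mono (G₁ ⊕ G₂) g₁₂≤a+b (proj₁ har₁₂))
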